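{- Let $\vec{a} = (a_1, a_2, \ldots)$ be a sequence of nonnegative integers, and let $\vec{h} = (h_1,h_2,\ldots)$ and $\vec{p} = (p_1,p_2,\ldots)$ be the unique sequences of rational numbers such that, in $\mathbb{Q}[[t]]$, \[ 1 + \sum_{k \geq 1} h_k t^k = \frac{1}{1 - \sum_{m \geq 1} a_m t^m} = \prod_{d \geq 1} \frac{1}{(1-t^d)^{p_d}}. \] Then $\vec{h} \geq \vec{p} \geq \vec{a} \geq \vec{0}$, i.e. $h_n \ge p_n \ge a_n \ge 0$ for all $n \ge 1$.
   Context: For a rational number $p$, $(1-t^d)^{ -p}$ denotes the formal power series $\sum_{m \ge 0} \binom{p+m-1}{m} t^{dm}$. Any one of the sequences $\vec h,\vec a,\vec p$ determines the other two uniquely via the displayed identity. For sequences $\vec{c},\vec{d}$, $\vec{c} \le \vec{d}$ means $c_n \le d_n$ for all $n \ge 1$, and $\vec{0}$ is the zero sequence. -}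

module Defs where

open import Data.Nat as ℕ using (ℕ; zero; suc; _∸_)
open import Data.Nat.Divisibility using (_∣?_)
open import Data.Nat.DivMod using (_/_)
open import Data.Integer using (+_)
open import Data.Rational as ℚ using (ℚ; 0ℚ; 1ℚ; _+_; _*_; -_)
open import Relation.Nullary using (yes; no)

-- Formal power series over ℚ, represented by coefficient sequences:
-- (F n) is the coefficient of t^n.
Series : Set
Series = ℕ → ℚ

ℕ→ℚ : ℕ → ℚ
ℕ→ℚ n = (+ n) ℚ./ 1

sumTo : ℕ → (ℕ → ℚ) → ℚ
sumTo zero    f = 0ℚ
sumTo (suc n) f = sumTo n f + f n

conv : Series → Series → Series
conv F G n = sumTo (suc n) (λ i → F i * G (n ∸ i))

oneS : Series
oneS zero    = 1ℚ
oneS (suc _) = 0ℚ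

-- Generalized binomial coefficient  binom(p+m-1, m) = ∏_{i<m} (p+i)/(i+1)
multichoose : ℚ → ℕ → ℚ
multichoose p zero    = 1ℚ
multichoose p (suc m) = multichoose p m * ((p + ℕ→ℚ m) * ((+ 1) ℚ./ suc m))

-- (1 - t^d)^{-p} = Σ_{m ≥ 0} binom(p+m-1, m) t^{dm}, for d = suc k ≥ 1
powFactor : ℚ → (k : ℕ) → Series
powFactor p k n with suc k ∣? n
... | yes _ = multichoose p (n / suc k)
... | no  _ = 0ℚ

prodUpTo : (ℕ → ℚ) → ℕ → Series
prodUpTo p zero    = oneS
prodUpTo p (suc N) = conv (prodUpTo p N) (powFactor (p (suc N)) N)

-- Coefficient of t^n in the infinite product ∏_{d ≥ 1} (1 - t^d)^{-p_d};
-- it only depends on the factors with d ≤ n.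
eulerProd : (ℕ → ℚ) → Series
eulerProd p n = prodUpTo p n n

-- 1 + Σ_{k≥1} h_k t^k   (h 0 is ignored)
hSeries : (ℕ → ℚ) → Series
hSeries h zero    = 1ℚ
hSeries h (suc k) = h (suc k)

-- 1 - Σ_{m≥1} a_m t^m   (a 0 is ignored)
oneMinusA : (ℕ → ℕ) → Series
oneMinusA a zero    = 1ℚ
oneMinusA a (suc m) = - ℕ→ℚ (a (suc m))

-- Write A = Σ a_m t^m. If d is the least degree with a_d ≠ 0, then
-- 1 - A = (1 - t^d)(1 - C) with C = (A - t^d)/(1 - t^d) = (A - t^d)(1 + t^d + t^2d + ⋯);
-- C again has natural coefficients, agrees with A below d, has c_d = a_d - 1 and
-- dominates A elsewhere. Peeling off such factors degree by degree writes 1/(1 - A),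
-- up to any degree N, as ∏_d (1 - t^d)^{-q_d} with natural exponents q_d ≥ a_d.
-- The coefficient of t^n in ∏_d (1 - t^d)^{-p_d} is p_n plus a polynomial in
-- p_1, …, p_{n-1}, so the exponents of an Euler product are determined by its
-- coefficients: p = q on [1, N]. Hence p_n ≥ a_n ≥ 0, and h_n ≥ p_n because the
-- remaining part of the coefficient is a coefficient of a product of series with
-- nonnegative coefficients.

module Submission where

open import Defs
open import Level using (0ℓ)
open import Function using (_∘_)
open import Data.Nat as ℕ using (ℕ; zero; suc; _∸_; _≥_; z≤n; s≤s)
import Data.Nat.Properties as ℕP
open import Data.Nat.Divisibility using (_∣_; _∣?_; ∣-refl; ∣m∣n⇒∣m+n; ∣m+n∣m⇒∣n; ∣⇒≤; divides)
open import Data.Nat.DivMod using (_/_; 0/n≡0; n/n≡1; m/n≡1+[m∸n]/n; m/n*n≡m)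
open import Data.Nat.Coprimality using (1-coprimeTo)
import Data.Nat.Coprimality as Coprimality
import Data.Integer as ℤ
import Data.Integer.Properties as ℤP
open import Data.Rational as ℚ using (ℚ; 0ℚ; 1ℚ; _+_; _*_; -_; _-_; mkℚ; _≤_)
import Data.Rational.Properties as ℚP
import Data.Rational.Unnormalised as ℚᵘ
import Data.Rational.Unnormalised.Properties as ℚᵘP
open import Data.Rational.Solver using (module +-*-Solver)
open +-*-Solver
open import Data.Product using (_,_; _×_)
open import Data.Sum using (inj₁; inj₂)
open import Relation.Nullary using (¬_; Dec; yes; no; contradiction)
open import Relation.Binary.Bundles using (Setoid)
open import Relation.Binary.PropositionalEquality
open ≡-Reasoning
open import Algebra.Bundles using (CommutativeMonoid)
open import Algebra.Properties.Group ℚP.+-0-group using () renaming (∙-cancelˡ to +-cancelˡ)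

ℕ→ℚ≡mkℚ : ∀ n → ℕ→ℚ n ≡ mkℚ (ℤ.+ n) 0 (Coprimality.sym (1-coprimeTo n))
ℕ→ℚ≡mkℚ n = ℚP.normalize-coprime _

ℕ→ℚ-suc : ∀ n → ℕ→ℚ (suc n) ≡ 1ℚ + ℕ→ℚ n
ℕ→ℚ-suc n rewrite ℕ→ℚ≡mkℚ n | ℕ→ℚ≡mkℚ (suc n) =
  ℚP.toℚᵘ-injective (ℚᵘP.≃-sym (ℚᵘP.≃-trans (ℚP.toℚᵘ-homo-+ 1ℚ n/1) (ℚᵘ.*≡* {x} {y} eq)))
  where
  n/1 : ℚ
  n/1 = mkℚ (ℤ.+ n) 0 (Coprimality.sym (1-coprimeTo n))
  x y : ℚᵘ.ℚᵘ
  x = ℚᵘ.mkℚᵘ (ℤ.+ 1) 0 ℚᵘ.+ ℚᵘ.mkℚᵘ (ℤ.+ n) 0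
  y = ℚᵘ.mkℚᵘ (ℤ.+ suc n) 0
  eq : ℚᵘ.↥ x ℤ.* ℚᵘ.↧ y ≡ ℚᵘ.↥ y ℤ.* ℚᵘ.↧ x
  eq rewrite ℕP.*-identityʳ n | ℤP.+◃n≡+n n | ℕP.*-identityʳ n = refl

ℕ→ℚ-+ : ∀ m n → ℕ→ℚ (m ℕ.+ n) ≡ ℕ→ℚ m + ℕ→ℚ n
ℕ→ℚ-+ zero    n = sym (ℚP.+-identityˡ (ℕ→ℚ n))
ℕ→ℚ-+ (suc m) n = begin
  ℕ→ℚ (suc (m ℕ.+ n))      ≡⟨ ℕ→ℚ-suc (m ℕ.+ n) ⟩
  1ℚ + ℕ→ℚ (m ℕ.+ n)       ≡⟨ cong (1ℚ +_) (ℕ→ℚ-+ m n) ⟩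
  1ℚ + (ℕ→ℚ m + ℕ→ℚ n)     ≡⟨ sym (ℚP.+-assoc 1ℚ (ℕ→ℚ m) (ℕ→ℚ n)) ⟩
  (1ℚ + ℕ→ℚ m) + ℕ→ℚ n     ≡⟨ cong (_+ ℕ→ℚ n) (sym (ℕ→ℚ-suc m)) ⟩
  ℕ→ℚ (suc m) + ℕ→ℚ n      ∎

ℕ→ℚ-* : ∀ m n → ℕ→ℚ (m ℕ.* n) ≡ ℕ→ℚ m * ℕ→ℚ n
ℕ→ℚ-* zero    n = sym (ℚP.*-zeroˡ (ℕ→ℚ n))
ℕ→ℚ-* (suc m) n = begin
  ℕ→ℚ (n ℕ.+ m ℕ.* n)      ≡⟨ ℕ→ℚ-+ n (m ℕ.* n) ⟩
  ℕ→ℚ n + ℕ→ℚ (m ℕ.* n)    ≡⟨ cong (ℕ→ℚ n +_) (ℕ→ℚ-* m n) ⟩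
  ℕ→ℚ n + ℕ→ℚ m * ℕ→ℚ n    ≡⟨ solve 2 (λ x y → x :+ y :* x := (con 1ℚ :+ y) :* x) refl (ℕ→ℚ n) (ℕ→ℚ m) ⟩
  (1ℚ + ℕ→ℚ m) * ℕ→ℚ n     ≡⟨ cong (_* ℕ→ℚ n) (sym (ℕ→ℚ-suc m)) ⟩
  ℕ→ℚ (suc m) * ℕ→ℚ n      ∎

ℕ→ℚ-nonNeg : ∀ n → 0ℚ ≤ ℕ→ℚ n
ℕ→ℚ-nonNeg n rewrite ℕ→ℚ≡mkℚ n = ℚP.nonNegative⁻¹ _

*-nonNeg : ∀ {p q} → 0ℚ ≤ p → 0ℚ ≤ q → 0ℚ ≤ p * q
*-nonNeg {p} {q} 0≤p 0≤q =
  ℚP.nonNegative⁻¹ _ {{ℚP.nonNeg*nonNeg⇒nonNeg p {{ℚ.nonNegative 0≤p}} q {{ℚ.nonNegative 0≤q}}}}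

+-nonNeg : ∀ {p q} → 0ℚ ≤ p → 0ℚ ≤ q → 0ℚ ≤ p + q
+-nonNeg {p} {q} 0≤p 0≤q =
  ℚP.nonNegative⁻¹ _ {{ℚP.nonNeg+nonNeg⇒nonNeg p {{ℚ.nonNegative 0≤p}} q {{ℚ.nonNegative 0≤q}}}}

q≤p+q : ∀ {p} q → 0ℚ ≤ p → q ≤ p + q
q≤p+q {p} q 0≤p = subst (_≤ p + q) (ℚP.+-identityˡ q) (ℚP.+-monoˡ-≤ q 0≤p)

ℕ→ℚ-mono-≤ : ∀ {m n} → m ℕ.≤ n → ℕ→ℚ m ≤ ℕ→ℚ n
ℕ→ℚ-mono-≤ {m} {n} m≤n = subst (ℕ→ℚ m ≤_) ℕ→ℚ[n∸m+m]≡ℕ→ℚn (q≤p+q (ℕ→ℚ m) (ℕ→ℚ-nonNeg (n ∸ m)))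
  where
  ℕ→ℚ[n∸m+m]≡ℕ→ℚn : ℕ→ℚ (n ∸ m) + ℕ→ℚ m ≡ ℕ→ℚ n
  ℕ→ℚ[n∸m+m]≡ℕ→ℚn = trans (sym (ℕ→ℚ-+ (n ∸ m) m)) (cong ℕ→ℚ (ℕP.m∸n+n≡m m≤n))

sumTo-cong : ∀ n {f g : ℕ → ℚ} → (∀ i → i ℕ.< n → f i ≡ g i) → sumTo n f ≡ sumTo n g
sumTo-cong zero    f≡g = refl
sumTo-cong (suc n) f≡g = cong₂ _+_ (sumTo-cong n (λ i i<n → f≡g i (ℕP.m<n⇒m<1+n i<n))) (f≡g n ℕP.≤-refl)

sumTo-zero : ∀ n {f : ℕ → ℚ} → (∀ i → i ℕ.< n → f i ≡ 0ℚ) → sumTo n f ≡ 0ℚ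
sumTo-zero zero    f≡0 = refl
sumTo-zero (suc n) f≡0 =
  cong₂ _+_ (sumTo-zero n (λ i i<n → f≡0 i (ℕP.m<n⇒m<1+n i<n))) (f≡0 n ℕP.≤-refl)

sumTo-suc : ∀ n (f : ℕ → ℚ) → sumTo (suc n) f ≡ f 0 + sumTo n (λ i → f (suc i))
sumTo-suc zero    f = ℚP.+-comm 0ℚ (f 0)
sumTo-suc (suc n) f = begin
  sumTo (suc n) f + f (suc n)                      ≡⟨ cong (_+ f (suc n)) (sumTo-suc n f) ⟩
  (f 0 + sumTo n (λ i → f (suc i))) + f (suc n)    ≡⟨ ℚP.+-assoc (f 0) _ _ ⟩
  f 0 + (sumTo n (λ i → f (suc i)) + f (suc n))    ∎

sumTo-reverse : ∀ n (f : ℕ → ℚ) → sumTo (suc n) f ≡ sumTo (suc n) (λ i → f (n ∸ i))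
sumTo-reverse zero    f = refl
sumTo-reverse (suc n) f = sym (begin
  sumTo (suc (suc n)) (λ i → f (suc n ∸ i))     ≡⟨ sumTo-suc (suc n) (λ i → f (suc n ∸ i)) ⟩
  f (suc n) + sumTo (suc n) (λ i → f (n ∸ i))   ≡⟨ cong (f (suc n) +_) (sym (sumTo-reverse n f)) ⟩
  f (suc n) + sumTo (suc n) f                   ≡⟨ ℚP.+-comm (f (suc n)) _ ⟩
  sumTo (suc n) f + f (suc n)                   ∎)

sumTo-distrib-+ : ∀ n (f g : ℕ → ℚ) → sumTo n (λ i → f i + g i) ≡ sumTo n f + sumTo n g
sumTo-distrib-+ zero    f g = refl
sumTo-distrib-+ (suc n) f g = begin
  sumTo n (λ i → f i + g i) + (f n + g n)  ≡⟨ cong (_+ (f n + g n)) (sumTo-distrib-+ n f g) ⟩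
  (sumTo n f + sumTo n g) + (f n + g n)    ≡⟨ solve 4 (λ a b c d → (a :+ b) :+ (c :+ d) := (a :+ c) :+ (b :+ d))
                                                refl (sumTo n f) (sumTo n g) (f n) (g n) ⟩
  (sumTo n f + f n) + (sumTo n g + g n)    ∎

sumTo-distrib-- : ∀ n (f g : ℕ → ℚ) → sumTo n (λ i → f i - g i) ≡ sumTo n f - sumTo n g
sumTo-distrib-- zero    f g = refl
sumTo-distrib-- (suc n) f g = begin
  sumTo n (λ i → f i - g i) + (f n - g n)  ≡⟨ cong (_+ (f n - g n)) (sumTo-distrib-- n f g) ⟩
  (sumTo n f - sumTo n g) + (f n - g n)    ≡⟨ solve 4 (λ a b c d → (a :- b) :+ (c :- d) := (a :+ c) :- (b :+ d))
                                                refl (sumTo n f) (sumTo n g) (f n) (g n) ⟩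
  (sumTo n f + f n) - (sumTo n g + g n)    ∎

sumTo-*ˡ : ∀ n c (f : ℕ → ℚ) → sumTo n (λ i → c * f i) ≡ c * sumTo n f
sumTo-*ˡ zero    c f = sym (ℚP.*-zeroʳ c)
sumTo-*ˡ (suc n) c f = begin
  sumTo n (λ i → c * f i) + c * f n  ≡⟨ cong (_+ c * f n) (sumTo-*ˡ n c f) ⟩
  c * sumTo n f + c * f n            ≡⟨ sym (ℚP.*-distribˡ-+ c _ _) ⟩
  c * (sumTo n f + f n)              ∎

sumTo-nonNeg : ∀ n (f : ℕ → ℚ) → (∀ i → 0ℚ ≤ f i) → 0ℚ ≤ sumTo n f
sumTo-nonNeg zero    f 0≤f = ℚP.≤-refl
sumTo-nonNeg (suc n) f 0≤f = +-nonNeg (sumTo-nonNeg n f 0≤f) (0≤f n)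

infix 4 _≈[_]_
_≈[_]_ : Series → ℕ → Series → Set
F ≈[ N ] G = ∀ n → n ℕ.≤ N → F n ≡ G n

conv-cong-upTo : ∀ {N F F′ G G′} → F ≈[ N ] F′ → G ≈[ N ] G′ → conv F G ≈[ N ] conv F′ G′
conv-cong-upTo F≈F′ G≈G′ n n≤N = sumTo-cong (suc n) λ i i≤n →
  cong₂ _*_ (F≈F′ i (ℕP.≤-trans (ℕP.≤-pred i≤n) n≤N)) (G≈G′ (n ∸ i) (ℕP.≤-trans (ℕP.m∸n≤m n i) n≤N))

conv-cong : ∀ {F F′ G G′} → F ≗ F′ → G ≗ G′ → conv F G ≗ conv F′ G′
conv-cong F≗F′ G≗G′ n = conv-cong-upTo (λ i _ → F≗F′ i) (λ i _ → G≗G′ i) n ℕP.≤-refl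

conv-congˡ : ∀ {F F′} G → F ≗ F′ → conv F G ≗ conv F′ G
conv-congˡ {F} {F′} G F≗F′ = conv-cong {F} {F′} {G} {G} F≗F′ (λ _ → refl)

conv-congʳ : ∀ F {G G′} → G ≗ G′ → conv F G ≗ conv F G′
conv-congʳ F {G} {G′} G≗G′ = conv-cong {F} {F} {G} {G′} (λ _ → refl) G≗G′

conv-suc : ∀ F G n → conv F G (suc n) ≡ F 0 * G (suc n) + conv (λ i → F (suc i)) G n
conv-suc F G n = sumTo-suc (suc n) (λ i → F i * G (suc n ∸ i))

conv-comm : ∀ F G → conv F G ≗ conv G F
conv-comm F G n = begin
  conv F G n                                             ≡⟨ sumTo-reverse n _ ⟩
  sumTo (suc n) (λ i → F (n ∸ i) * G (n ∸ (n ∸ i)))      ≡⟨ sumTo-cong (suc n) swap ⟩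
  conv G F n                                             ∎
  where
  swap : ∀ i → i ℕ.< suc n → F (n ∸ i) * G (n ∸ (n ∸ i)) ≡ G i * F (n ∸ i)
  swap i i<1+n = trans (cong (λ j → F (n ∸ i) * G j) (ℕP.m∸[m∸n]≡n (ℕP.≤-pred i<1+n)))
                       (ℚP.*-comm (F (n ∸ i)) (G i))

conv-distribʳ-+ : ∀ F F′ G n → conv (λ i → F i + F′ i) G n ≡ conv F G n + conv F′ G n
conv-distribʳ-+ F F′ G n =
  trans (sumTo-cong (suc n) (λ i _ → ℚP.*-distribʳ-+ (G (n ∸ i)) (F i) (F′ i))) (sumTo-distrib-+ (suc n) _ _)

conv-distribʳ-- : ∀ F F′ G n → conv (λ i → F i - F′ i) G n ≡ conv F G n - conv F′ G n
conv-distribʳ-- F F′ G n = trans (sumTo-cong (suc n) (λ i _ → distrib (F i) (F′ i) (G (n ∸ i))))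
                                 (sumTo-distrib-- (suc n) _ _)
  where
  distrib : ∀ x y z → (x - y) * z ≡ x * z - y * z
  distrib = solve 3 (λ x y z → (x :- y) :* z := x :* z :- y :* z) refl

conv-distribˡ-- : ∀ F G G′ n → conv F (λ i → G i - G′ i) n ≡ conv F G n - conv F G′ n
conv-distribˡ-- F G G′ n = begin
  conv F (λ i → G i - G′ i) n  ≡⟨ conv-comm F (λ i → G i - G′ i) n ⟩
  conv (λ i → G i - G′ i) F n  ≡⟨ conv-distribʳ-- G G′ F n ⟩
  conv G F n - conv G′ F n     ≡⟨ cong₂ _-_ (conv-comm G F n) (conv-comm G′ F n) ⟩
  conv F G n - conv F G′ n     ∎

conv-*ˡ : ∀ c F G n → conv (λ i → c * F i) G n ≡ c * conv F G n
conv-*ˡ c F G n = trans (sumTo-cong (suc n) (λ i _ → ℚP.*-assoc c (F i) _)) (sumTo-*ˡ (suc n) c _)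

conv-identityˡ : ∀ G → conv oneS G ≗ G
conv-identityˡ G zero    = solve 1 (λ x → con 0ℚ :+ con 1ℚ :* x := x) refl (G 0)
conv-identityˡ G (suc n) = begin
  conv oneS G (suc n)                             ≡⟨ conv-suc oneS G n ⟩
  1ℚ * G (suc n) + conv (λ _ → 0ℚ) G n            ≡⟨ cong (1ℚ * G (suc n) +_) (sumTo-zero (suc n) (λ i _ → ℚP.*-zeroˡ (G (n ∸ i)))) ⟩
  1ℚ * G (suc n) + 0ℚ                             ≡⟨ solve 1 (λ x → con 1ℚ :* x :+ con 0ℚ := x) refl (G (suc n)) ⟩
  G (suc n)                                       ∎

conv-identityʳ : ∀ F → conv F oneS ≗ F
conv-identityʳ F n = trans (conv-comm F oneS n) (conv-identityˡ F n)

conv-assoc : ∀ F G H → conv (conv F G) H ≗ conv F (conv G H)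
conv-assoc F G H zero    = solve 3 (λ f g h → con 0ℚ :+ (con 0ℚ :+ f :* g) :* h := con 0ℚ :+ f :* (con 0ℚ :+ g :* h))
                                   refl (F 0) (G 0) (H 0)
conv-assoc F G H (suc n) = begin
  conv (conv F G) H (suc n)                                    ≡⟨ conv-suc (conv F G) H n ⟩
  conv F G 0 * H (suc n) + conv (λ i → conv F G (suc i)) H n   ≡⟨ cong (conv F G 0 * H (suc n) +_) tail ⟩
  conv F G 0 * H (suc n) + (F 0 * conv G↑ H n + conv F↑ (conv G H) n)
    ≡⟨ solve 5 (λ f g h x y → (con 0ℚ :+ f :* g) :* h :+ (f :* x :+ y) := f :* (g :* h :+ x) :+ y)
               refl (F 0) (G 0) (H (suc n)) (conv G↑ H n) (conv F↑ (conv G H) n) ⟩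
  F 0 * (G 0 * H (suc n) + conv G↑ H n) + conv F↑ (conv G H) n  ≡⟨ cong (λ x → F 0 * x + conv F↑ (conv G H) n) (sym (conv-suc G H n)) ⟩
  F 0 * conv G H (suc n) + conv F↑ (conv G H) n                 ≡⟨ sym (conv-suc F (conv G H) n) ⟩
  conv F (conv G H) (suc n)                                     ∎
  where
  F↑ G↑ : Series
  F↑ i = F (suc i)
  G↑ i = G (suc i)
  tail : conv (λ i → conv F G (suc i)) H n ≡ F 0 * conv G↑ H n + conv F↑ (conv G H) n
  tail = begin
    conv (λ i → conv F G (suc i)) H n                 ≡⟨ conv-congˡ H (conv-suc F G) n ⟩
    conv (λ i → F 0 * G↑ i + conv F↑ G i) H n         ≡⟨ conv-distribʳ-+ (λ i → F 0 * G↑ i) (conv F↑ G) H n ⟩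
    conv (λ i → F 0 * G↑ i) H n + conv (conv F↑ G) H n ≡⟨ cong₂ _+_ (conv-*ˡ (F 0) G↑ H n) (conv-assoc F↑ G H n) ⟩
    F 0 * conv G↑ H n + conv F↑ (conv G H) n          ∎

conv-nonNeg : ∀ F G → (∀ i → 0ℚ ≤ F i) → (∀ i → 0ℚ ≤ G i) → ∀ n → 0ℚ ≤ conv F G n
conv-nonNeg F G 0≤F 0≤G n = sumTo-nonNeg (suc n) (λ i → F i * G (n ∸ i)) (λ i → *-nonNeg (0≤F i) (0≤G (n ∸ i)))

conv-commutativeMonoid : CommutativeMonoid 0ℓ 0ℓ
conv-commutativeMonoid = record
  { Carrier             = Series
  ; _≈_                 = _≗_
  ; _∙_                 = conv
  ; ε                   = oneS
  ; isCommutativeMonoid = record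
    { isMonoid = record
      { isSemigroup = record
        { isMagma = record
          { isEquivalence = Setoid.isEquivalence (ℕ →-setoid ℚ)
          ; ∙-cong        = conv-cong
          }
        ; assoc = conv-assoc
        }
      ; identity = conv-identityˡ , conv-identityʳ
      }
    ; comm = conv-comm
    }
  }

open import Algebra.Properties.CommutativeSemigroup
  (CommutativeMonoid.commutativeSemigroup conv-commutativeMonoid)
  using (interchange; x∙yz≈y∙xz)

conv-cancelˡ : ∀ {F G} → conv F G ≗ oneS → ∀ X → conv F (conv G X) ≗ X
conv-cancelˡ {F} {G} FG≗1 X n = begin
  conv F (conv G X) n  ≡⟨ sym (conv-assoc F G X n) ⟩
  conv (conv F G) X n  ≡⟨ conv-congˡ X FG≗1 n ⟩
  conv oneS X n        ≡⟨ conv-identityˡ X n ⟩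
  X n                  ∎

inverse-unique-upTo : ∀ {N X A Y} → conv X A ≈[ N ] oneS → conv A Y ≈[ N ] oneS → X ≈[ N ] Y
inverse-unique-upTo {N} {X} {A} {Y} XA≈1 AY≈1 n n≤N = begin
  X n                  ≡⟨ sym (conv-identityʳ X n) ⟩
  conv X oneS n        ≡⟨ conv-cong-upTo {F = X} {G = oneS} (λ _ _ → refl) (λ i i≤N → sym (AY≈1 i i≤N)) n n≤N ⟩
  conv X (conv A Y) n  ≡⟨ sym (conv-assoc X A Y n) ⟩
  conv (conv X A) Y n  ≡⟨ conv-cong-upTo {G = Y} XA≈1 (λ _ _ → refl) n n≤N ⟩
  conv oneS Y n        ≡⟨ conv-identityˡ Y n ⟩
  Y n                  ∎

shift : ℕ → Series → Series
shift zero    X n       = X n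
shift (suc d) X zero    = 0ℚ
shift (suc d) X (suc n) = shift d X n

shift-< : ∀ d X n → n ℕ.< d → shift d X n ≡ 0ℚ
shift-< (suc d) X zero    _         = refl
shift-< (suc d) X (suc n) (s≤s n<d) = shift-< d X n n<d

shift-+ : ∀ d X j → shift d X (d ℕ.+ j) ≡ X j
shift-+ zero    X j = refl
shift-+ (suc d) X j = shift-+ d X j

conv-shiftˡ : ∀ d F X → conv (shift d F) X ≗ shift d (conv F X)
conv-shiftˡ zero    F X n       = refl
conv-shiftˡ (suc d) F X zero    = solve 1 (λ x → con 0ℚ :+ con 0ℚ :* x := con 0ℚ) refl (X 0)
conv-shiftˡ (suc d) F X (suc n) = begin
  conv (shift (suc d) F) X (suc n)             ≡⟨ conv-suc (shift (suc d) F) X n ⟩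
  0ℚ * X (suc n) + conv (shift d F) X n        ≡⟨ cong (0ℚ * X (suc n) +_) (conv-shiftˡ d F X n) ⟩
  0ℚ * X (suc n) + shift d (conv F X) n        ≡⟨ solve 2 (λ x y → con 0ℚ :* x :+ y := y) refl (X (suc n)) _ ⟩
  shift d (conv F X) n                         ∎

monomial : ℕ → Series
monomial d = shift d oneS

monomial-≡ : ∀ d → monomial d d ≡ 1ℚ
monomial-≡ zero    = refl
monomial-≡ (suc d) = monomial-≡ d

monomial-≢ : ∀ d i → i ≢ d → monomial d i ≡ 0ℚ
monomial-≢ zero    zero    i≢d = contradiction refl i≢d
monomial-≢ zero    (suc i) i≢d = refl
monomial-≢ (suc d) zero    i≢d = refl
monomial-≢ (suc d) (suc i) i≢d = monomial-≢ d i (i≢d ∘ cong suc)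

conv-monomialˡ : ∀ d X → conv (monomial d) X ≗ shift d X
conv-monomialˡ d X n = trans (conv-shiftˡ d oneS X n) (shift-cong d (conv-identityˡ X) n)
  where
  shift-cong : ∀ d {X Y} → X ≗ Y → shift d X ≗ shift d Y
  shift-cong zero    X≗Y n       = X≗Y n
  shift-cong (suc d) X≗Y zero    = refl
  shift-cong (suc d) X≗Y (suc n) = shift-cong d X≗Y n

1/suc : ℕ → ℚ
1/suc m = (ℤ.+ 1) ℚ./ suc m

1/suc≡mkℚ : ∀ m → 1/suc m ≡ mkℚ (ℤ.+ 1) m (1-coprimeTo (suc m))
1/suc≡mkℚ m = ℚP.normalize-coprime _

ℕ→ℚ[1+m]*1/suc[m]≡1 : ∀ m → ℕ→ℚ (suc m) * 1/suc m ≡ 1ℚ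
ℕ→ℚ[1+m]*1/suc[m]≡1 m rewrite ℕ→ℚ≡mkℚ (suc m) | 1/suc≡mkℚ m =
  ℚP.*-inverseʳ (mkℚ (ℤ.+ suc m) 0 (Coprimality.sym (1-coprimeTo (suc m))))

1/suc-nonNeg : ∀ m → 0ℚ ≤ 1/suc m
1/suc-nonNeg m rewrite 1/suc≡mkℚ m = ℚP.nonNegative⁻¹ _

multichoose-absorption : ∀ p n → p * multichoose (p + 1ℚ) n ≡ (p + ℕ→ℚ n) * multichoose p n
multichoose-absorption p zero    = solve 1 (λ p → p :* con 1ℚ := (p :+ con 0ℚ) :* con 1ℚ) refl p
multichoose-absorption p (suc n) = begin
  p * (A * ((p + 1ℚ + s) * r))   ≡⟨ solve 4 (λ p A s r → p :* (A :* ((p :+ con 1ℚ :+ s) :* r)) := (p :* A) :* ((p :+ con 1ℚ :+ s) :* r))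
                                          refl p A s r ⟩
  (p * A) * ((p + 1ℚ + s) * r)   ≡⟨ cong (_* ((p + 1ℚ + s) * r)) (multichoose-absorption p n) ⟩
  ((p + s) * B) * ((p + 1ℚ + s) * r)
                                 ≡⟨ solve 4 (λ p B s r → ((p :+ s) :* B) :* ((p :+ con 1ℚ :+ s) :* r) := (p :+ (con 1ℚ :+ s)) :* (B :* ((p :+ s) :* r)))
                                          refl p B s r ⟩
  (p + (1ℚ + s)) * (B * ((p + s) * r))  ≡⟨ cong (λ x → (p + x) * (B * ((p + s) * r))) (sym (ℕ→ℚ-suc n)) ⟩
  (p + ℕ→ℚ (suc n)) * multichoose p (suc n)  ∎
  where
  A = multichoose (p + 1ℚ) n
  B = multichoose p n
  s = ℕ→ℚ n
  r = 1/suc n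

multichoose-pascal : ∀ p n → multichoose (p + 1ℚ) (suc n) ≡ multichoose p (suc n) + multichoose (p + 1ℚ) n
multichoose-pascal p n = begin
  A * ((p + 1ℚ + s) * r)            ≡⟨ solve 4 (λ A p s r → A :* ((p :+ con 1ℚ :+ s) :* r) := (p :* A) :* r :+ A :* ((con 1ℚ :+ s) :* r))
                                             refl A p s r ⟩
  (p * A) * r + A * ((1ℚ + s) * r)  ≡⟨ cong₂ (λ x y → x * r + A * y) (multichoose-absorption p n)
                                             (trans (cong (_* r) (sym (ℕ→ℚ-suc n))) (ℕ→ℚ[1+m]*1/suc[m]≡1 n)) ⟩
  ((p + s) * B) * r + A * 1ℚ        ≡⟨ solve 5 (λ p s B r A → ((p :+ s) :* B) :* r :+ A :* con 1ℚ := B :* ((p :+ s) :* r) :+ A)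
                                             refl p s B r A ⟩
  B * ((p + s) * r) + A             ∎
  where
  A = multichoose (p + 1ℚ) n
  B = multichoose p n
  s = ℕ→ℚ n
  r = 1/suc n

multichoose-0ℚ : ∀ n → multichoose 0ℚ (suc n) ≡ 0ℚ
multichoose-0ℚ zero    = refl
multichoose-0ℚ (suc n) = trans (cong (_* ((0ℚ + ℕ→ℚ (suc n)) * 1/suc (suc n))) (multichoose-0ℚ n))
                               (ℚP.*-zeroˡ ((0ℚ + ℕ→ℚ (suc n)) * 1/suc (suc n)))

multichoose-1ℚ : ∀ n → multichoose 1ℚ n ≡ 1ℚ
multichoose-1ℚ zero    = refl
multichoose-1ℚ (suc n) = begin
  multichoose 1ℚ n * ((1ℚ + ℕ→ℚ n) * 1/suc n)  ≡⟨ cong₂ (λ x y → x * (y * 1/suc n)) (multichoose-1ℚ n) (sym (ℕ→ℚ-suc n)) ⟩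
  1ℚ * (ℕ→ℚ (suc n) * 1/suc n)                 ≡⟨ cong (1ℚ *_) (ℕ→ℚ[1+m]*1/suc[m]≡1 n) ⟩
  1ℚ                                            ∎

multichoose-1 : ∀ p → multichoose p 1 ≡ p
multichoose-1 p = solve 1 (λ p → con 1ℚ :* ((p :+ con 0ℚ) :* con 1ℚ) := p) refl p

multichoose-nonNeg : ∀ {p} n → 0ℚ ≤ p → 0ℚ ≤ multichoose p n
multichoose-nonNeg zero    0≤p = ℚP.nonNegative⁻¹ 1ℚ
multichoose-nonNeg (suc n) 0≤p =
  *-nonNeg (multichoose-nonNeg n 0≤p) (*-nonNeg (+-nonNeg 0≤p (ℕ→ℚ-nonNeg n)) (1/suc-nonNeg n))

-- The factors (1 - t^d)^{-q}

powFactor-∣ : ∀ q k {n} → suc k ∣ n → powFactor q k n ≡ multichoose q (n / suc k)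
powFactor-∣ q k {n} d∣n with suc k ∣? n
... | yes _   = refl
... | no  d∤n = contradiction d∣n d∤n

powFactor-∤ : ∀ q k {n} → ¬ (suc k ∣ n) → powFactor q k n ≡ 0ℚ
powFactor-∤ q k {n} d∤n with suc k ∣? n
... | yes d∣n = contradiction d∣n d∤n
... | no  _   = refl

powFactor-≤ : ∀ q k {j} → j ℕ.≤ k → powFactor q k j ≡ oneS j
powFactor-≤ q k {zero}  _   = trans (powFactor-∣ q k (divides 0 refl)) (cong (multichoose q) (0/n≡0 (suc k)))
powFactor-≤ q k {suc j} j≤k = powFactor-∤ q k λ d∣j → ℕP.<-irrefl refl (ℕP.≤-trans (∣⇒≤ d∣j) j≤k)

powFactor-self : ∀ q k → powFactor q k (suc k) ≡ q
powFactor-self q k = trans (powFactor-∣ q k ∣-refl) (trans (cong (multichoose q) (n/n≡1 (suc k))) (multichoose-1 q))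

powFactor-nonNeg : ∀ {q} k n → 0ℚ ≤ q → 0ℚ ≤ powFactor q k n
powFactor-nonNeg k n 0≤q with suc k ∣? n
... | yes _ = multichoose-nonNeg (n / suc k) 0≤q
... | no  _ = ℚP.≤-refl

powFactor-0ℚ : ∀ k → powFactor 0ℚ k ≗ oneS
powFactor-0ℚ k zero    = powFactor-≤ 0ℚ k z≤n
powFactor-0ℚ k (suc n) with suc k ∣? suc n
... | no  _   = refl
... | yes d∣n = vanish (suc n / suc k) (m/n*n≡m d∣n)
  where
  vanish : ∀ m → m ℕ.* suc k ≡ suc n → multichoose 0ℚ m ≡ 0ℚ
  vanish (suc m) _ = multichoose-0ℚ m

powFactor-pascal : ∀ q k n → powFactor (q + 1ℚ) k n ≡ powFactor q k n + shift (suc k) (powFactor (q + 1ℚ) k) n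
powFactor-pascal q k n with n ℕP.<? suc k
... | yes n<d = begin
  P n             ≡⟨ powFactor-≤ (q + 1ℚ) k (ℕP.≤-pred n<d) ⟩
  oneS n          ≡⟨ sym (ℚP.+-identityʳ (oneS n)) ⟩
  oneS n + 0ℚ     ≡⟨ sym (cong₂ _+_ (powFactor-≤ q k (ℕP.≤-pred n<d)) (shift-< (suc k) P n n<d)) ⟩
  powFactor q k n + shift (suc k) P n  ∎
  where P = powFactor (q + 1ℚ) k
... | no  n≮d = subst (λ n → P n ≡ powFactor q k n + shift (suc k) P n)
                      (ℕP.m+[n∸m]≡n (ℕP.≮⇒≥ n≮d))
                      (trans (beyond (n ∸ suc k) (suc k ∣? (n ∸ suc k)))
                             (cong (powFactor q k (suc k ℕ.+ (n ∸ suc k)) +_) (sym (shift-+ (suc k) P (n ∸ suc k)))))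
  where
  P = powFactor (q + 1ℚ) k
  beyond : ∀ j → Dec (suc k ∣ j) → P (suc k ℕ.+ j) ≡ powFactor q k (suc k ℕ.+ j) + P j
  beyond j (yes d∣j) = begin
    P (suc k ℕ.+ j)                                 ≡⟨ powFactor-∣ (q + 1ℚ) k d∣d+j ⟩
    multichoose (q + 1ℚ) ((suc k ℕ.+ j) / suc k)    ≡⟨ cong (multichoose (q + 1ℚ)) [d+j]/d≡1+j/d ⟩
    multichoose (q + 1ℚ) (suc (j / suc k))          ≡⟨ multichoose-pascal q (j / suc k) ⟩
    multichoose q (suc (j / suc k)) + multichoose (q + 1ℚ) (j / suc k)
                                                    ≡⟨ sym (cong₂ _+_ (trans (powFactor-∣ q k d∣d+j) (cong (multichoose q) [d+j]/d≡1+j/d))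
                                                                      (powFactor-∣ (q + 1ℚ) k d∣j)) ⟩
    powFactor q k (suc k ℕ.+ j) + P j               ∎
    where
    d∣d+j : suc k ∣ suc k ℕ.+ j
    d∣d+j = ∣m∣n⇒∣m+n ∣-refl d∣j
    [d+j]/d≡1+j/d : (suc k ℕ.+ j) / suc k ≡ suc (j / suc k)
    [d+j]/d≡1+j/d = trans (m/n≡1+[m∸n]/n (ℕP.m≤m+n (suc k) j)) (cong (λ x → suc (x / suc k)) (ℕP.m+n∸m≡n (suc k) j))
  beyond j (no d∤j) = begin
    P (suc k ℕ.+ j)                    ≡⟨ powFactor-∤ (q + 1ℚ) k d∤d+j ⟩
    0ℚ + 0ℚ                            ≡⟨ sym (cong₂ _+_ (powFactor-∤ q k d∤d+j) (powFactor-∤ (q + 1ℚ) k d∤j)) ⟩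
    powFactor q k (suc k ℕ.+ j) + P j  ∎
    where
    d∤d+j : ¬ (suc k ∣ suc k ℕ.+ j)
    d∤d+j d∣d+j = d∤j (∣m+n∣m⇒∣n d∣d+j ∣-refl)

oneMinusT^suc : ℕ → Series
oneMinusT^suc k i = oneS i - monomial (suc k) i

geometric : ℕ → Series
geometric k = powFactor 1ℚ k

conv-oneMinusT^suc : ∀ k X n → conv (oneMinusT^suc k) X n ≡ X n - shift (suc k) X n
conv-oneMinusT^suc k X n = begin
  conv (oneMinusT^suc k) X n                      ≡⟨ conv-distribʳ-- oneS (monomial (suc k)) X n ⟩
  conv oneS X n - conv (monomial (suc k)) X n     ≡⟨ cong₂ _-_ (conv-identityˡ X n) (conv-monomialˡ (suc k) X n) ⟩
  X n - shift (suc k) X n                         ∎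

conv-oneMinusT^suc-powFactor : ∀ q k → conv (oneMinusT^suc k) (powFactor (q + 1ℚ) k) ≗ powFactor q k
conv-oneMinusT^suc-powFactor q k n = begin
  conv (oneMinusT^suc k) P n                         ≡⟨ conv-oneMinusT^suc k P n ⟩
  P n - shift (suc k) P n                            ≡⟨ cong (_- shift (suc k) P n) (powFactor-pascal q k n) ⟩
  (powFactor q k n + shift (suc k) P n) - shift (suc k) P n
                                                     ≡⟨ solve 2 (λ a b → (a :+ b) :- b := a) refl (powFactor q k n) (shift (suc k) P n) ⟩
  powFactor q k n                                    ∎
  where P = powFactor (q + 1ℚ) k

geometric-inverse : ∀ k → conv (geometric k) (oneMinusT^suc k) ≗ oneS
geometric-inverse k n = begin
  conv (geometric k) (oneMinusT^suc k) n                  ≡⟨ conv-comm (geometric k) (oneMinusT^suc k) n ⟩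
  conv (oneMinusT^suc k) (powFactor (0ℚ + 1ℚ) k) n        ≡⟨ conv-oneMinusT^suc-powFactor 0ℚ k n ⟩
  powFactor 0ℚ k n                                        ≡⟨ powFactor-0ℚ k n ⟩
  oneS n                                                  ∎

powFactor-+1 : ∀ q k → powFactor (q + 1ℚ) k ≗ conv (geometric k) (powFactor q k)
powFactor-+1 q k n = begin
  P n                                                    ≡⟨ sym (conv-cancelˡ {geometric k} {oneMinusT^suc k} (geometric-inverse k) P n) ⟩
  conv (geometric k) (conv (oneMinusT^suc k) P) n        ≡⟨ conv-congʳ (geometric k) (conv-oneMinusT^suc-powFactor q k) n ⟩
  conv (geometric k) (powFactor q k) n                   ∎
  where P = powFactor (q + 1ℚ) k

-- Euler products

prodUpTo-0 : ∀ p N → prodUpTo p N 0 ≡ 1ℚ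
prodUpTo-0 p zero    = refl
prodUpTo-0 p (suc N) = cong₂ (λ x y → 0ℚ + x * y) (prodUpTo-0 p N) (powFactor-≤ (p (suc N)) N z≤n)

prodUpTo-stable : ∀ p N {n} → n ℕ.≤ N → prodUpTo p (suc N) n ≡ prodUpTo p N n
prodUpTo-stable p N {n} n≤N =
  trans (conv-cong-upTo {n} {prodUpTo p N} {prodUpTo p N} {powFactor (p (suc N)) N} {oneS} (λ _ _ → refl)
                        (λ i i≤n → powFactor-≤ (p (suc N)) N (ℕP.≤-trans i≤n n≤N)) n ℕP.≤-refl)
        (conv-identityʳ (prodUpTo p N) n)

prodUpTo≡eulerProd : ∀ p M {n} → n ℕ.≤ M → prodUpTo p M n ≡ eulerProd p n
prodUpTo≡eulerProd p zero    z≤n   = refl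
prodUpTo≡eulerProd p (suc M) n≤1+M with ℕP.m≤n⇒m<n∨m≡n n≤1+M
... | inj₁ n<1+M = trans (prodUpTo-stable p M (ℕP.≤-pred n<1+M)) (prodUpTo≡eulerProd p M (ℕP.≤-pred n<1+M))
... | inj₂ refl  = refl

eulerProd-suc : ∀ p k → eulerProd p (suc k) ≡ prodUpTo p k (suc k) + p (suc k)
eulerProd-suc p k = begin
  conv X P (suc k)                                              ≡⟨ conv-comm X P (suc k) ⟩
  conv P X (suc k)                                              ≡⟨ conv-suc P X k ⟩
  P 0 * X (suc k) + (sumTo k (λ i → P (suc i) * X (k ∸ i)) + P (suc k) * X (k ∸ k))
                                                                ≡⟨ cong₂ (λ a b → a * X (suc k) + (b + P (suc k) * X (k ∸ k)))
                                                                         (powFactor-≤ (p (suc k)) k z≤n) (sumTo-zero k low) ⟩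
  1ℚ * X (suc k) + (0ℚ + P (suc k) * X (k ∸ k))                 ≡⟨ cong₂ (λ a b → 1ℚ * X (suc k) + (0ℚ + a * b))
                                                                         (powFactor-self (p (suc k)) k)
                                                                         (trans (cong X (ℕP.n∸n≡0 k)) (prodUpTo-0 p k)) ⟩
  1ℚ * X (suc k) + (0ℚ + p (suc k) * 1ℚ)                        ≡⟨ solve 2 (λ x y → con 1ℚ :* x :+ (con 0ℚ :+ y :* con 1ℚ) := x :+ y)
                                                                         refl (X (suc k)) (p (suc k)) ⟩
  X (suc k) + p (suc k)                                         ∎
  where
  X = prodUpTo p k
  P = powFactor (p (suc k)) k
  low : ∀ i → i ℕ.< k → P (suc i) * X (k ∸ i) ≡ 0ℚ
  low i i<k = trans (cong (_* X (k ∸ i)) (powFactor-≤ (p (suc k)) k i<k)) (ℚP.*-zeroˡ (X (k ∸ i)))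

prodUpTo-cong : ∀ {p p′} N → (∀ d → 0 ℕ.< d → d ℕ.≤ N → p d ≡ p′ d) → prodUpTo p N ≗ prodUpTo p′ N
prodUpTo-cong zero    p≡p′ = λ _ → refl
prodUpTo-cong (suc N) p≡p′ =
  conv-cong (prodUpTo-cong N λ d 0<d d≤N → p≡p′ d 0<d (ℕP.m≤n⇒m≤1+n d≤N))
            (λ i → cong (λ x → powFactor x N i) (p≡p′ (suc N) (s≤s z≤n) ℕP.≤-refl))

prodUpTo-nonNeg : ∀ {p} N → (∀ d → 0 ℕ.< d → d ℕ.≤ N → 0ℚ ≤ p d) → ∀ n → 0ℚ ≤ prodUpTo p N n
prodUpTo-nonNeg zero    0≤p zero    = ℚP.nonNegative⁻¹ 1ℚ
prodUpTo-nonNeg zero    0≤p (suc n) = ℚP.≤-refl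
prodUpTo-nonNeg (suc N) 0≤p =
  conv-nonNeg _ _ (prodUpTo-nonNeg N λ d 0<d d≤N → 0≤p d 0<d (ℕP.m≤n⇒m≤1+n d≤N))
                  (λ i → powFactor-nonNeg N i (0≤p (suc N) (s≤s z≤n) ℕP.≤-refl))

prodUpTo-0ℚ : ∀ N → prodUpTo (λ _ → 0ℚ) N ≗ oneS
prodUpTo-0ℚ zero    n = refl
prodUpTo-0ℚ (suc N) n = begin
  conv (prodUpTo (λ _ → 0ℚ) N) (powFactor 0ℚ N) n  ≡⟨ conv-cong (prodUpTo-0ℚ N) (powFactor-0ℚ N) n ⟩
  conv oneS oneS n                                ≡⟨ conv-identityˡ oneS n ⟩
  oneS n                                          ∎

eulerProd-injective-upTo : ∀ {p p′} N → eulerProd p ≈[ N ] eulerProd p′ → ∀ d → 0 ℕ.< d → d ℕ.≤ N → p d ≡ p′ d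
eulerProd-injective-upTo zero    _ d 0<d d≤0 = contradiction (ℕP.<-≤-trans 0<d d≤0) λ ()
eulerProd-injective-upTo {p} {p′} (suc N) E = extend
  where
  agree : ∀ d → 0 ℕ.< d → d ℕ.≤ N → p d ≡ p′ d
  agree = eulerProd-injective-upTo N (λ n n≤N → E n (ℕP.m≤n⇒m≤1+n n≤N))
  top : p (suc N) ≡ p′ (suc N)
  top = +-cancelˡ (prodUpTo p N (suc N)) (p (suc N)) (p′ (suc N)) (begin
    prodUpTo p N (suc N) + p (suc N)    ≡⟨ sym (eulerProd-suc p N) ⟩
    eulerProd p (suc N)                 ≡⟨ E (suc N) ℕP.≤-refl ⟩
    eulerProd p′ (suc N)                ≡⟨ eulerProd-suc p′ N ⟩
    prodUpTo p′ N (suc N) + p′ (suc N)  ≡⟨ cong (_+ p′ (suc N)) (sym (prodUpTo-cong N agree (suc N))) ⟩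
    prodUpTo p N (suc N) + p′ (suc N)   ∎)
  extend : ∀ d → 0 ℕ.< d → d ℕ.≤ suc N → p d ≡ p′ d
  extend d 0<d d≤1+N with ℕP.m≤n⇒m<n∨m≡n d≤1+N
  ... | inj₁ d<1+N = agree d 0<d (ℕP.≤-pred d<1+N)
  ... | inj₂ refl  = top

module _ {p p′ : ℕ → ℚ} (k : ℕ) (p≡p′+1 : p (suc k) ≡ p′ (suc k) + 1ℚ) (p≡p′ : ∀ d → d ≢ suc k → p d ≡ p′ d) where

  prodUpTo-increment : ∀ N → suc k ℕ.≤ N → prodUpTo p N ≗ conv (geometric k) (prodUpTo p′ N)
  prodUpTo-increment (suc N) (s≤s k≤N) n with ℕP.m≤n⇒m<n∨m≡n k≤N
  ... | inj₁ k<N = begin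
    conv (prodUpTo p N) (powFactor (p (suc N)) N) n                         ≡⟨ conv-cong (prodUpTo-increment N k<N) same n ⟩
    conv (conv (geometric k) (prodUpTo p′ N)) (powFactor (p′ (suc N)) N) n
      ≡⟨ conv-assoc (geometric k) (prodUpTo p′ N) (powFactor (p′ (suc N)) N) n ⟩
    conv (geometric k) (prodUpTo p′ (suc N)) n                              ∎
    where
    same : powFactor (p (suc N)) N ≗ powFactor (p′ (suc N)) N
    same i = cong (λ x → powFactor x N i) (p≡p′ (suc N) λ 1+N≡1+k → ℕP.<-irrefl (sym 1+N≡1+k) (s≤s k<N))
  ... | inj₂ refl = begin
    conv (prodUpTo p k) (powFactor (p (suc k)) k) n                         ≡⟨ conv-cong below raised n ⟩
    conv (prodUpTo p′ k) (conv (geometric k) (powFactor (p′ (suc k)) k)) n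
      ≡⟨ x∙yz≈y∙xz (prodUpTo p′ k) (geometric k) (powFactor (p′ (suc k)) k) n ⟩
    conv (geometric k) (prodUpTo p′ (suc k)) n                              ∎
    where
    below : prodUpTo p k ≗ prodUpTo p′ k
    below = prodUpTo-cong k λ d _ d≤k → p≡p′ d λ d≡1+k → ℕP.<-irrefl d≡1+k (s≤s d≤k)
    raised : powFactor (p (suc k)) k ≗ conv (geometric k) (powFactor (p′ (suc k)) k)
    raised i = trans (cong (λ x → powFactor x k i) p≡p′+1) (powFactor-+1 (p′ (suc k)) k i)

  eulerProd-increment : eulerProd p ≗ conv (geometric k) (eulerProd p′)
  eulerProd-increment n = begin
    eulerProd p n                              ≡⟨ sym (prodUpTo≡eulerProd p M (ℕP.m≤m+n n (suc k))) ⟩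
    prodUpTo p M n                             ≡⟨ prodUpTo-increment M (ℕP.m≤n+m (suc k) n) n ⟩
    conv (geometric k) (prodUpTo p′ M) n       ≡⟨ conv-cong-upTo {n} {geometric k} {geometric k} (λ _ _ → refl) stable n ℕP.≤-refl ⟩
    conv (geometric k) (eulerProd p′) n        ∎
    where
    M = n ℕ.+ suc k
    stable : prodUpTo p′ M ≈[ n ] eulerProd p′
    stable i i≤n = prodUpTo≡eulerProd p′ M (ℕP.≤-trans i≤n (ℕP.m≤m+n n (suc k)))

sumToℕ : ℕ → (ℕ → ℕ) → ℕ
sumToℕ zero    f = 0
sumToℕ (suc n) f = sumToℕ n f ℕ.+ f n

sumToℕ-suc : ∀ n f → sumToℕ (suc n) f ≡ f 0 ℕ.+ sumToℕ n (λ i → f (suc i))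
sumToℕ-suc zero    f = ℕP.+-comm 0 (f 0)
sumToℕ-suc (suc n) f = trans (cong (ℕ._+ f (suc n)) (sumToℕ-suc n f)) (ℕP.+-assoc (f 0) _ (f (suc n)))

sumToℕ-zero : ∀ n {f} → (∀ i → i ℕ.< n → f i ≡ 0) → sumToℕ n f ≡ 0
sumToℕ-zero zero    f≡0 = refl
sumToℕ-zero (suc n) f≡0 = cong₂ ℕ._+_ (sumToℕ-zero n λ i i<n → f≡0 i (ℕP.m<n⇒m<1+n i<n)) (f≡0 n ℕP.≤-refl)

ℕ→ℚ-sumToℕ : ∀ n f → ℕ→ℚ (sumToℕ n f) ≡ sumTo n (ℕ→ℚ ∘ f)
ℕ→ℚ-sumToℕ zero    f = refl
ℕ→ℚ-sumToℕ (suc n) f = trans (ℕ→ℚ-+ (sumToℕ n f) (f n)) (cong (_+ ℕ→ℚ (f n)) (ℕ→ℚ-sumToℕ n f))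

convℕ : (ℕ → ℕ) → (ℕ → ℕ) → ℕ → ℕ
convℕ f g n = sumToℕ (suc n) (λ i → f i ℕ.* g (n ∸ i))

ℕ→ℚ-convℕ : ∀ f g n → ℕ→ℚ (convℕ f g n) ≡ conv (ℕ→ℚ ∘ f) (ℕ→ℚ ∘ g) n
ℕ→ℚ-convℕ f g n = trans (ℕ→ℚ-sumToℕ (suc n) _) (sumTo-cong (suc n) λ i _ → ℕ→ℚ-* (f i) (g (n ∸ i)))

convℕ-≥ : ∀ {f} g n → f 0 ≡ 1 → g n ℕ.≤ convℕ f g n
convℕ-≥ {f} g n f0≡1 = subst₂ ℕ._≤_ f0*gn≡gn (sym (sumToℕ-suc n (λ i → f i ℕ.* g (n ∸ i)))) (ℕP.m≤m+n (f 0 ℕ.* g n) _)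
  where
  f0*gn≡gn : f 0 ℕ.* g n ≡ g n
  f0*gn≡gn = trans (cong (ℕ._* g n) f0≡1) (ℕP.*-identityˡ (g n))

convℕ-low : ∀ {f g} n → f 0 ≡ 1 → (∀ i → 0 ℕ.< i → i ℕ.< n → f i ≡ 0) → g 0 ≡ 0 → convℕ f g n ≡ g n
convℕ-low {f} {g} n f0≡1 f≡0 g0≡0 = begin
  convℕ f g n                                               ≡⟨ sumToℕ-suc n _ ⟩
  f 0 ℕ.* g n ℕ.+ sumToℕ n (λ i → f (suc i) ℕ.* g (n ∸ suc i)) ≡⟨ cong₂ (λ x y → x ℕ.* g n ℕ.+ y) f0≡1 (sumToℕ-zero n vanish) ⟩
  1 ℕ.* g n ℕ.+ 0                                           ≡⟨ trans (ℕP.+-identityʳ _) (ℕP.*-identityˡ _) ⟩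
  g n                                                       ∎
  where
  vanish : ∀ i → i ℕ.< n → f (suc i) ℕ.* g (n ∸ suc i) ≡ 0
  vanish i i<n with ℕP.m≤n⇒m<n∨m≡n i<n
  ... | inj₁ 1+i<n = cong (ℕ._* g (n ∸ suc i)) (f≡0 (suc i) (s≤s z≤n) 1+i<n)
  ... | inj₂ refl  = trans (cong (λ x → f (suc i) ℕ.* g x) (ℕP.n∸n≡0 (suc i)))
                           (trans (cong (f (suc i) ℕ.*_) g0≡0) (ℕP.*-zeroʳ (f (suc i))))

-- Peeling a factor 1 - t^d off 1 - A

oneMinusA≗oneS-ℕ→ℚ : ∀ {a} → a 0 ≡ 0 → ∀ n → oneMinusA a n ≡ oneS n - ℕ→ℚ (a n)
oneMinusA≗oneS-ℕ→ℚ a0≡0 zero    = cong (λ x → 1ℚ - ℕ→ℚ x) (sym a0≡0)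
oneMinusA≗oneS-ℕ→ℚ a0≡0 (suc n) = sym (ℚP.+-identityˡ _)

infixl 9 _[_≔_]
_[_≔_] : ∀ {A : Set} → (ℕ → A) → ℕ → A → ℕ → A
(f [ j ≔ x ]) i with i ℕ.≟ j
... | yes _ = x
... | no  _ = f i

[≔]-≡ : ∀ {A : Set} (f : ℕ → A) j x → (f [ j ≔ x ]) j ≡ x
[≔]-≡ f j x with j ℕ.≟ j
... | yes _   = refl
... | no  j≢j = contradiction refl j≢j

[≔]-≢ : ∀ {A : Set} (f : ℕ → A) {i j} x → i ≢ j → (f [ j ≔ x ]) i ≡ f i
[≔]-≢ f {i} {j} x i≢j with i ℕ.≟ j
... | yes i≡j = contradiction i≡j i≢j
... | no  _   = refl

multipleIndicator : ℕ → ℕ → ℕ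
multipleIndicator k i with suc k ∣? i
... | yes _ = 1
... | no  _ = 0

multipleIndicator-0 : ∀ k → multipleIndicator k 0 ≡ 1
multipleIndicator-0 k with suc k ∣? 0
... | yes _   = refl
... | no  d∤0 = contradiction (divides 0 refl) d∤0

multipleIndicator-≤ : ∀ k i → 0 ℕ.< i → i ℕ.≤ k → multipleIndicator k i ≡ 0
multipleIndicator-≤ k i 0<i i≤k with suc k ∣? i
... | yes d∣i = contradiction (ℕP.≤-trans (∣⇒≤ ⦃ ℕ.>-nonZero 0<i ⦄ d∣i) i≤k) (ℕP.<-irrefl refl)
... | no  _   = refl

geometric≗multipleIndicator : ∀ k → geometric k ≗ ℕ→ℚ ∘ multipleIndicator k
geometric≗multipleIndicator k i with suc k ∣? i
... | yes _ = multichoose-1ℚ (i / suc k)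
... | no  _ = refl

-- b and c are the coefficients of A - t^(1+k) and of C = (A - t^(1+k))/(1 - t^(1+k)).
module Peel (k : ℕ) (a : ℕ → ℕ) (v : ℕ) (a[1+k]≡1+v : a (suc k) ≡ suc v) where

  b : ℕ → ℕ
  b zero    = 0
  b (suc i) = (a [ suc k ≔ v ]) (suc i)

  c : ℕ → ℕ
  c = convℕ (multipleIndicator k) b

  c-low : ∀ n → n ℕ.≤ suc k → c n ≡ b n
  c-low n n≤1+k = convℕ-low {multipleIndicator k} {b} n (multipleIndicator-0 k)
    (λ i 0<i i<n → multipleIndicator-≤ k i 0<i (ℕP.≤-pred (ℕP.<-≤-trans i<n n≤1+k))) refl

  c-self : c (suc k) ≡ v
  c-self = trans (c-low (suc k) ℕP.≤-refl) ([≔]-≡ a (suc k) v)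

  c-≥ : ∀ j → 0 ℕ.< j → j ≢ suc k → a j ℕ.≤ c j
  c-≥ (suc j) _ 1+j≢1+k = subst (ℕ._≤ c (suc j)) ([≔]-≢ a v 1+j≢1+k) (convℕ-≥ {multipleIndicator k} b (suc j) (multipleIndicator-0 k))

  c-vanishes : (∀ i → 0 ℕ.< i → i ℕ.≤ k → a i ≡ 0) → ∀ i → 0 ℕ.< i → i ℕ.≤ k → c i ≡ 0
  c-vanishes a≡0 (suc i) 0<i i≤k = begin
    c (suc i)                    ≡⟨ c-low (suc i) (ℕP.m≤n⇒m≤1+n i≤k) ⟩
    (a [ suc k ≔ v ]) (suc i)    ≡⟨ [≔]-≢ a v (λ 1+i≡1+k → ℕP.<-irrefl 1+i≡1+k (s≤s i≤k)) ⟩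
    a (suc i)                    ≡⟨ a≡0 (suc i) 0<i i≤k ⟩
    0                            ∎

  oneMinusA≡oneMinusT^suc-b : ∀ n → oneMinusA a n ≡ oneMinusT^suc k n - ℕ→ℚ (b n)
  oneMinusA≡oneMinusT^suc-b zero    = refl
  oneMinusA≡oneMinusT^suc-b (suc n) = dispatch (suc n ℕ.≟ suc k)
    where
    dispatch : Dec (suc n ≡ suc k) → oneMinusA a (suc n) ≡ oneMinusT^suc k (suc n) - ℕ→ℚ (b (suc n))
    dispatch (yes 1+n≡1+k) = subst (λ i → - ℕ→ℚ (a i) ≡ oneMinusT^suc k i - ℕ→ℚ ((a [ suc k ≔ v ]) i)) (sym 1+n≡1+k) (begin
      - ℕ→ℚ (a (suc k))         ≡⟨ cong (-_ ∘ ℕ→ℚ) a[1+k]≡1+v ⟩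
      - ℕ→ℚ (suc v)             ≡⟨ cong -_ (ℕ→ℚ-suc v) ⟩
      - (1ℚ + ℕ→ℚ v)            ≡⟨ solve 1 (λ x → :- (con 1ℚ :+ x) := (con 0ℚ :- con 1ℚ) :- x) refl (ℕ→ℚ v) ⟩
      (0ℚ - 1ℚ) - ℕ→ℚ v         ≡⟨ sym (cong₂ (λ x y → (0ℚ - x) - ℕ→ℚ y) (monomial-≡ (suc k)) ([≔]-≡ a (suc k) v)) ⟩
      oneMinusT^suc k (suc k) - ℕ→ℚ ((a [ suc k ≔ v ]) (suc k))  ∎)
    dispatch (no 1+n≢1+k) = begin
      - ℕ→ℚ (a (suc n))            ≡⟨ solve 1 (λ x → :- x := (con 0ℚ :- con 0ℚ) :- x) refl (ℕ→ℚ (a (suc n))) ⟩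
      (0ℚ - 0ℚ) - ℕ→ℚ (a (suc n))
        ≡⟨ sym (cong₂ (λ x y → (0ℚ - x) - ℕ→ℚ y) (monomial-≢ (suc k) (suc n) 1+n≢1+k) ([≔]-≢ a v 1+n≢1+k)) ⟩
      oneMinusT^suc k (suc n) - ℕ→ℚ (b (suc n))  ∎

  oneMinusA-factor : ∀ n → oneMinusA a n ≡ conv (oneMinusT^suc k) (oneMinusA c) n
  oneMinusA-factor n = begin
    oneMinusA a n                                          ≡⟨ oneMinusA≡oneMinusT^suc-b n ⟩
    D n - B n                                              ≡⟨ cong₂ _-_ (sym (conv-identityʳ D n)) (sym (conv-cancelˡ {D} {geometric k} D∙G≗1 B n)) ⟩
    conv D oneS n - conv D (conv (geometric k) B) n        ≡⟨ cong (λ x → conv D oneS n - x) (sym (conv-congʳ D C≗G∙B n)) ⟩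
    conv D oneS n - conv D C n                             ≡⟨ sym (conv-distribˡ-- D oneS C n) ⟩
    conv D (λ i → oneS i - C i) n                          ≡⟨ sym (conv-congʳ D (oneMinusA≗oneS-ℕ→ℚ (c-low 0 z≤n)) n) ⟩
    conv D (oneMinusA c) n                                 ∎
    where
    D B C : Series
    D = oneMinusT^suc k
    B = ℕ→ℚ ∘ b
    C = ℕ→ℚ ∘ c
    D∙G≗1 : conv D (geometric k) ≗ oneS
    D∙G≗1 i = trans (conv-comm D (geometric k) i) (geometric-inverse k i)
    C≗G∙B : C ≗ conv (geometric k) B
    C≗G∙B i = trans (ℕ→ℚ-convℕ (multipleIndicator k) b i) (conv-congˡ B (λ j → sym (geometric≗multipleIndicator k j)) i)

VanishesUpTo : ℕ → (ℕ → ℕ) → Set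
VanishesUpTo k a = ∀ i → 0 ℕ.< i → i ℕ.≤ k → a i ≡ 0

record EulerFactorisation (N : ℕ) (a : ℕ → ℕ) : Set where
  field
    exponent  : ℕ → ℕ
    inverts   : conv (eulerProd (ℕ→ℚ ∘ exponent)) (oneMinusA a) ≈[ N ] oneS
    dominates : ∀ d → 0 ℕ.< d → d ℕ.≤ N → a d ℕ.≤ exponent d

factorisation-vanishing : ∀ {N a} → VanishesUpTo N a → EulerFactorisation N a
factorisation-vanishing {N} {a} a≡0 = record
  { exponent  = λ _ → 0
  ; inverts   = λ n n≤N → begin
      conv (eulerProd (λ _ → 0ℚ)) (oneMinusA a) n  ≡⟨ conv-congˡ (oneMinusA a) (λ i → prodUpTo-0ℚ i i) n ⟩
      conv oneS (oneMinusA a) n                    ≡⟨ conv-identityˡ (oneMinusA a) n ⟩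
      oneMinusA a n                                ≡⟨ oneMinusA≡oneS n n≤N ⟩
      oneS n                                       ∎
  ; dominates = λ d 0<d d≤N → ℕP.≤-reflexive (a≡0 d 0<d d≤N)
  }
  where
  oneMinusA≡oneS : ∀ n → n ℕ.≤ N → oneMinusA a n ≡ oneS n
  oneMinusA≡oneS zero    _     = refl
  oneMinusA≡oneS (suc n) 1+n≤N = cong (-_ ∘ ℕ→ℚ) (a≡0 (suc n) (s≤s z≤n) 1+n≤N)

factorisation-peel : ∀ {N} k a v (a[1+k]≡1+v : a (suc k) ≡ suc v) →
                     EulerFactorisation N (Peel.c k a v a[1+k]≡1+v) → EulerFactorisation N a
factorisation-peel {N} k a v a[1+k]≡1+v F = record
  { exponent  = q
  ; inverts   = λ n n≤N → begin
      conv (eulerProd (ℕ→ℚ ∘ q)) (oneMinusA a) n         ≡⟨ conv-cong (eulerProd-increment k raised same) (oneMinusA-factor) n ⟩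
      conv (conv G E′) (conv D (oneMinusA c)) n          ≡⟨ interchange G E′ D (oneMinusA c) n ⟩
      conv (conv G D) (conv E′ (oneMinusA c)) n          ≡⟨ conv-congˡ (conv E′ (oneMinusA c)) (geometric-inverse k) n ⟩
      conv oneS (conv E′ (oneMinusA c)) n                ≡⟨ conv-identityˡ (conv E′ (oneMinusA c)) n ⟩
      conv E′ (oneMinusA c) n                            ≡⟨ inverts n n≤N ⟩
      oneS n                                             ∎
  ; dominates = λ d 0<d d≤N → dominated d 0<d (dominates d 0<d d≤N) (d ℕ.≟ suc k)
  }
  where
  open Peel k a v a[1+k]≡1+v
  open EulerFactorisation F
  q : ℕ → ℕ
  q = exponent [ suc k ≔ suc (exponent (suc k)) ]
  G D E′ : Series
  G  = geometric k
  D  = oneMinusT^suc k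
  E′ = eulerProd (ℕ→ℚ ∘ exponent)
  raised : ℕ→ℚ (q (suc k)) ≡ ℕ→ℚ (exponent (suc k)) + 1ℚ
  raised = trans (cong ℕ→ℚ ([≔]-≡ exponent (suc k) _))
                 (trans (ℕ→ℚ-suc (exponent (suc k))) (ℚP.+-comm 1ℚ (ℕ→ℚ (exponent (suc k)))))
  same : ∀ d → d ≢ suc k → ℕ→ℚ (q d) ≡ ℕ→ℚ (exponent d)
  same d d≢1+k = cong ℕ→ℚ ([≔]-≢ exponent _ d≢1+k)
  dominated : ∀ d → 0 ℕ.< d → c d ℕ.≤ exponent d → Dec (d ≡ suc k) → a d ℕ.≤ q d
  dominated d _   c≤e (yes refl)   = subst₂ ℕ._≤_ (sym a[1+k]≡1+v) (sym ([≔]-≡ exponent (suc k) _))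
                                            (s≤s (subst (ℕ._≤ exponent (suc k)) c-self c≤e))
  dominated d 0<d c≤e (no d≢1+k) = subst (a d ℕ.≤_) (sym ([≔]-≢ exponent _ d≢1+k)) (ℕP.≤-trans (c-≥ d 0<d d≢1+k) c≤e)

-- Lexicographic induction: on the number r of degrees still to be cleared, and,
-- within a degree 1 + k, on the coefficient a (1 + k), lowered by one per peeled factor.
factorisation-from : ∀ N r k → k ℕ.+ r ≡ N → ∀ a → VanishesUpTo k a → EulerFactorisation N a
factorisation-from N zero    k k+0≡N a a≡0 =
  factorisation-vanishing (subst (λ m → VanishesUpTo m a) (trans (sym (ℕP.+-identityʳ k)) k+0≡N) a≡0)
factorisation-from N (suc r) k k+1+r≡N a a≡0 = peel (a (suc k)) a a≡0 refl
  where
  peel : ∀ v a → VanishesUpTo k a → a (suc k) ≡ v → EulerFactorisation N a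
  peel zero    a a≡0 a[1+k]≡0 = factorisation-from N r (suc k) (trans (sym (ℕP.+-suc k r)) k+1+r≡N) a a≡0′
    where
    a≡0′ : VanishesUpTo (suc k) a
    a≡0′ i 0<i i≤1+k with ℕP.m≤n⇒m<n∨m≡n i≤1+k
    ... | inj₁ i<1+k = a≡0 i 0<i (ℕP.≤-pred i<1+k)
    ... | inj₂ refl  = a[1+k]≡0
  peel (suc v) a a≡0 a[1+k]≡1+v =
    factorisation-peel k a v a[1+k]≡1+v (peel v c (c-vanishes a≡0) c-self)
    where open Peel k a v a[1+k]≡1+v

factorisation : ∀ N a → EulerFactorisation N a
factorisation N a = factorisation-from N N 0 refl a λ i 0<i i≤0 → contradiction (ℕP.<-≤-trans 0<i i≤0) λ ()

corollary2p8 : (a : ℕ → ℕ) (h p : ℕ → ℚ)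
    → (∀ n → conv (hSeries h) (oneMinusA a) n ≡ oneS n)
    → (∀ n → hSeries h n ≡ eulerProd p n)
    → ∀ n → n ≥ 1
    → (p n ≤ h n) × (ℕ→ℚ (a n) ≤ p n) × (0ℚ ≤ ℕ→ℚ (a n))
corollary2p8 a h p h∙[1-A]≡1 h≡Πp (suc m) _ = p≤h , a≤p , ℕ→ℚ-nonNeg (a (suc m))
  where
  open EulerFactorisation (factorisation (suc m) a)
  [1-A]∙Πp≈1 : conv (oneMinusA a) (eulerProd p) ≈[ suc m ] oneS
  [1-A]∙Πp≈1 n _ = begin
    conv (oneMinusA a) (eulerProd p) n  ≡⟨ conv-comm (oneMinusA a) (eulerProd p) n ⟩
    conv (eulerProd p) (oneMinusA a) n  ≡⟨ conv-congˡ (oneMinusA a) (sym ∘ h≡Πp) n ⟩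
    conv (hSeries h) (oneMinusA a) n    ≡⟨ h∙[1-A]≡1 n ⟩
    oneS n                              ∎
  p≡exponent : ∀ d → 0 ℕ.< d → d ℕ.≤ suc m → p d ≡ ℕ→ℚ (exponent d)
  p≡exponent d 0<d d≤1+m =
    sym (eulerProd-injective-upTo (suc m) (inverse-unique-upTo {A = oneMinusA a} {Y = eulerProd p} inverts [1-A]∙Πp≈1) d 0<d d≤1+m)
  a≤p : ℕ→ℚ (a (suc m)) ≤ p (suc m)
  a≤p = subst (ℕ→ℚ (a (suc m)) ≤_) (sym (p≡exponent (suc m) (s≤s z≤n) ℕP.≤-refl))
              (ℕ→ℚ-mono-≤ (dominates (suc m) (s≤s z≤n) ℕP.≤-refl))
  p≤h : p (suc m) ≤ h (suc m)
  p≤h = subst (p (suc m) ≤_) (sym (trans (h≡Πp (suc m)) (eulerProd-suc p m)))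
              (q≤p+q (p (suc m)) (prodUpTo-nonNeg m 0≤p (suc m)))
    where
    0≤p : ∀ d → 0 ℕ.< d → d ℕ.≤ m → 0ℚ ≤ p d
    0≤p d 0<d d≤m = subst (0ℚ ≤_) (sym (p≡exponent d 0<d (ℕP.m≤n⇒m≤1+n d≤m))) (ℕ→ℚ-nonNeg (exponent d))
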